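{- Let $(G,A,k,\ell)$ be a yes-instance of $(A,\ell)$-Path Packing. Let $M\subseteq V(G)$ be such that $G-M$ is a disjoint union of cliques, with $m=|M|$, and fix a marking of $V(G)\setminus M$ produced by the marking procedure described in the context. Then there is a collection $\mathcal{P}$ of $k$ pairwise vertex-disjoint $A$-paths of length exactly $\ell$ in $G$ with the following property: every vertex of a path in $\mathcal{P}$ that contains at least one vertex of $M$ is either in $M$ or is marked.
   Context: For an undirected graph $G$ and $A\subseteq V(G)$, an $A$-path is a path in $G$ that starts and ends at two distinct vertices of $A$ and whose internal vertices all lie in $V(G)\setminus A$. $(A,\ell)$-Path Packing asks, given $G$, $A\subseteq V(G)$ and integers $k,\ell$, whether $G$ has $k$ pairwise vertex-disjoint $A$-paths each of length exactly $\ell$. Marking procedure. Let $M\subseteq V(G)$ be such that $G-M$ is a disjoint union of cliques, and let $m=|M|$. Carry out the following for every clique $Q$ of $G-M$: (1) For each $u\in M$, mark $\ell m+1$ vertices of $N(u)\cap A\cap V(Q)$ (all of them if there are fewer). Likewise, mark $\ell m+1$ vertices of $N(u)\cap (V(Q)\setminus A)$ (all of them if there are fewer). (2) For each pair $u,v\in M$, mark $\ell m+1$ common neighbours of $u$ and $v$ in $V(Q)\setminus A$ (all of them if there are fewer). (3) Additionally, mark $\ell m+1$ vertices of $A\cap V(Q)$ and $\ell m+1$ vertices of $V(Q)\setminus A$ (all of them if there are fewer). The choices of which vertices to mark are arbitrary. -}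

module Defs where

open import Data.Nat using (ℕ; suc; _+_; _*_; _⊓_)
open import Data.Fin using (Fin; _≟_)
open import Data.Fin.Subset using (Subset; _∈_; _∉_; _⊆_; ∣_∣; ∁; _∩_)
open import Data.Bool using (Bool; true; false; not; _∧_; _∨_)
open import Data.Vec using (lookup; tabulate)
open import Data.Product using (Σ; _×_; ∃)
open import Data.Sum using (_⊎_)
open import Relation.Nullary using (¬_; ⌊_⌋)
open import Relation.Binary.PropositionalEquality using (_≡_; _≢_)

record Graph (n : ℕ) : Set where
  field
    adj     : Fin n → Fin n → Bool
    adj-sym : ∀ x y → adj x y ≡ adj y x
    adj-irr : ∀ x → adj x x ≡ false

open Graph public

Edge : ∀ {n} → Graph n → Fin n → Fin n → Set
Edge G x y = adj G x y ≡ true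

Nbh : ∀ {n} → Graph n → Fin n → Subset n
Nbh G u = tabulate (adj G u)

record Path {n : ℕ} (G : Graph n) (ℓ : ℕ) : Set where
  field
    vtx      : Fin (suc ℓ) → Fin n
    distinct : ∀ i j → vtx i ≡ vtx j → i ≡ j
    edges    : ∀ (i : Fin ℓ) → Edge G (vtx (Data.Fin.inject₁ i)) (vtx (Data.Fin.suc i))

open Path public

IsAPath : ∀ {n ℓ} (G : Graph n) (A : Subset n) → Path G ℓ → Set
IsAPath {ℓ = ℓ} G A P =
  (vtx P Data.Fin.zero ∈ A) × (vtx P (Data.Fin.fromℕ ℓ) ∈ A)
  × (vtx P Data.Fin.zero ≢ vtx P (Data.Fin.fromℕ ℓ))
  × (∀ (i : Fin (suc ℓ)) → i ≢ Data.Fin.zero → i ≢ Data.Fin.fromℕ ℓ → vtx P i ∉ A)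

record Packing {n : ℕ} (G : Graph n) (A : Subset n) (k ℓ : ℕ) : Set where
  field
    path     : Fin k → Path G ℓ
    isAPath  : ∀ i → IsAPath G A (path i)
    disjoint : ∀ i j → i ≢ j → ∀ p q → vtx (path i) p ≢ vtx (path j) q

open Packing public

-- G - M is a disjoint union of cliques: adjacency-or-equality is transitive outside M.
IsClusterDeletion : ∀ {n} → Graph n → Subset n → Set
IsClusterDeletion {n} G M =
  ∀ (x y z : Fin n) → x ∉ M → y ∉ M → z ∉ M →
  Edge G x y → Edge G y z → x ≢ z → Edge G x z

cliqueOf : ∀ {n} → Graph n → Subset n → Fin n → Subset n
cliqueOf G M v = tabulate (λ w → not (lookup M w) ∧ (⌊ w ≟ v ⌋ ∨ adj G w v))

Chosen : ∀ {n} → ℕ → Subset n → Subset n → Set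
Chosen b T S = (S ⊆ T) × (∣ S ∣ ≡ b ⊓ ∣ T ∣)

-- The choices made by the marking procedure, one set per clique Q (indexed by the
-- clique as a subset) and per vertex / pair of vertices of M.
record MarkingChoice {n : ℕ} (G : Graph n) (A M : Subset n) (ℓ : ℕ) : Set where
  field
    sel1A : Subset n → Fin n → Subset n
    sel1N : Subset n → Fin n → Subset n
    sel2  : Subset n → Fin n → Fin n → Subset n
    sel3A : Subset n → Subset n
    sel3N : Subset n → Subset n
  b : ℕ
  b = ℓ * ∣ M ∣ + 1
  field
    ok1A  : ∀ v → v ∉ M → ∀ u → u ∈ M →
            Chosen b (cliqueOf G M v ∩ (A ∩ Nbh G u)) (sel1A (cliqueOf G M v) u)
    ok1N  : ∀ v → v ∉ M → ∀ u → u ∈ M →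
            Chosen b (cliqueOf G M v ∩ (∁ A ∩ Nbh G u)) (sel1N (cliqueOf G M v) u)
    ok2   : ∀ v → v ∉ M → ∀ u w → u ∈ M → w ∈ M → u ≢ w →
            Chosen b (cliqueOf G M v ∩ (∁ A ∩ (Nbh G u ∩ Nbh G w))) (sel2 (cliqueOf G M v) u w)
    sym2  : ∀ Q u w → sel2 Q u w ≡ sel2 Q w u
    ok3A  : ∀ v → v ∉ M → Chosen b (cliqueOf G M v ∩ A) (sel3A (cliqueOf G M v))
    ok3N  : ∀ v → v ∉ M → Chosen b (cliqueOf G M v ∩ ∁ A) (sel3N (cliqueOf G M v))

open MarkingChoice public

Marked : ∀ {n ℓ} {G : Graph n} {A M : Subset n} → MarkingChoice G A M ℓ → Fin n → Set
Marked {n} {G = G} {M = M} mc x =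
  Σ (Fin n) λ v → v ∉ M ×
    ( (Σ (Fin n) λ u → u ∈ M ×
         (x ∈ sel1A mc (Q v) u ⊎ x ∈ sel1N mc (Q v) u))
    ⊎ (Σ (Fin n) λ u → Σ (Fin n) λ w → u ∈ M × w ∈ M × u ≢ w × x ∈ sel2 mc (Q v) u w)
    ⊎ x ∈ sel3A mc (Q v)
    ⊎ x ∈ sel3N mc (Q v))
  where
  Q : Fin n → Subset n
  Q = cliqueOf G M

-- Improve the packing one vertex at a time.  Let x ∉ M be an unmarked vertex.  The marking step
-- that matches x (its A-membership and its neighbours in M along its path) chose ℓm+1 vertices
-- of x's clique from a set containing x, so it chose exactly ℓm+1 vertices, all different from x.
-- Every vertex u ∈ M has only ℓ other vertices on its path, so at most ℓm vertices outside M lie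
-- on paths meeting M, and some chosen y lies on no such path.  Transposing x and y yields again
-- a packing of A-paths: y sees x's neighbours in M by the choice of the marking step and x's other
-- neighbours inside the clique, while all neighbours of y on its path lie in the clique of x.
-- Afterwards x lies on a path avoiding M, y is marked, and every other vertex keeps its status.
module Submission where

open import Data.Bool using (Bool; true; false)
open import Data.Bool.Properties using (T-≡; T-not-≡; T-∧; T-∨)
open import Data.Empty using (⊥-elim)
open import Data.Fin using (Fin; zero; suc; inject₁; toℕ; punchIn; punchOut)
open import Data.Fin.Permutation.Components using (transpose; transpose-inverse)
open import Data.Fin.Properties
  using (any?; _≟_; suc-injective; inject₁-injective; fromℕ≢inject₁; toℕ-inject₁; punchIn-punchOut)
open import Data.Fin.Subset using (Subset; inside; outside; _∈_; _∉_; _⊆_; ∣_∣; ∁; _∩_; _∪_; ⊥; ⊤; ⁅_⁆; _-_)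
open import Data.Fin.Subset.Properties
  using ( _∈?_; p⊆p∪q; q⊆p∪q; x∈⁅x⁆; ∣⁅x⁆∣≡1; ∣⊥∣≡0; ∣⊤∣≡n; ∈⊤; p⊆q⇒∣p∣≤∣q∣; x∈p⇒∣p-x∣<∣p∣
        ; x∈p∧x≢y⇒x∈p-y; x∈p∩q⁺; x∈p∩q⁻; x∈∁p⇒x∉p; x∉p⇒x∈∁p)
open import Data.List using (List; []; _∷_; allFin)
open import Data.List.Membership.Propositional.Properties using (∈-allFin)
open import Data.List.Relation.Unary.All as All using (All; []; _∷_)
open import Data.Nat using (ℕ; suc; _+_; _*_; _≤_; _<_; z≤n; s≤s)
open import Data.Nat.Properties
  using ( ≤-trans; ≤-reflexive; +-monoʳ-≤; +-mono-≤; n≤1+n; +-suc; *-identityʳ; *-comm; ≤-total; ≤-<-trans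
        ; <⇒≢; <⇒≱; m≤n⇒m⊓n≡m; m≥n⇒m⊓n≡n; m≢1+n+m; m<m+n; module ≤-Reasoning)
open import Data.Product using (Σ; ∃; ∃₂; _×_; _,_; proj₁; proj₂)
open import Data.Sum using (_⊎_; inj₁; inj₂)
import Data.Sum as Sum
open import Data.Vec using ([]; _∷_; here; there; lookup; tabulate)
open import Data.Vec.Properties using ([]=⇒lookup; lookup⇒[]=; lookup∘tabulate)
open import Function using (_∘_; const; _⇔_; mk⇔; Equivalence)
open import Function.Definitions using (Injective)
import Function.Properties.Equivalence as ⇔
open import Relation.Nullary using (⌊_⌋; ¬_; Dec; yes; no; ¬?; contradiction)
open import Relation.Nullary.Decidable using (map′; _×-dec_; _⊎-dec_; toWitness; fromWitness)
open import Relation.Binary.PropositionalEquality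
  using (_≡_; _≢_; refl; sym; trans; subst; subst₂; cong; module ≡-Reasoning)

open import Defs

private variable
  n m a : ℕ

-- Counting in finite subsets

∣p∪q∣≤∣p∣+∣q∣ : (p q : Subset n) → ∣ p ∪ q ∣ ≤ ∣ p ∣ + ∣ q ∣
∣p∪q∣≤∣p∣+∣q∣ []            []            = z≤n
∣p∪q∣≤∣p∣+∣q∣ (inside  ∷ p) (inside  ∷ q) = s≤s (≤-trans (∣p∪q∣≤∣p∣+∣q∣ p q) (+-monoʳ-≤ ∣ p ∣ (n≤1+n ∣ q ∣)))
∣p∪q∣≤∣p∣+∣q∣ (inside  ∷ p) (outside ∷ q) = s≤s (∣p∪q∣≤∣p∣+∣q∣ p q)
∣p∪q∣≤∣p∣+∣q∣ (outside ∷ p) (inside  ∷ q) = ≤-trans (s≤s (∣p∪q∣≤∣p∣+∣q∣ p q)) (≤-reflexive (sym (+-suc ∣ p ∣ ∣ q ∣)))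
∣p∪q∣≤∣p∣+∣q∣ (outside ∷ p) (outside ∷ q) = ∣p∪q∣≤∣p∣+∣q∣ p q

⋃[_]_ : Subset m → (Fin m → Subset n) → Subset n
⋃[ []          ] f = ⊥
⋃[ inside  ∷ I ] f = f zero ∪ ⋃[ I ] (f ∘ suc)
⋃[ outside ∷ I ] f = ⋃[ I ] (f ∘ suc)

∣⋃[]∣≤ : ∀ {c} (I : Subset m) (f : Fin m → Subset n) → (∀ i → ∣ f i ∣ ≤ c) → ∣ ⋃[ I ] f ∣ ≤ ∣ I ∣ * c
∣⋃[]∣≤ {n = n} []  f ∣f∣≤c = subst (_≤ 0) (sym (∣⊥∣≡0 n)) z≤n
∣⋃[]∣≤ (inside  ∷ I) f ∣f∣≤c =
  ≤-trans (∣p∪q∣≤∣p∣+∣q∣ (f zero) _) (+-mono-≤ (∣f∣≤c zero) (∣⋃[]∣≤ I (f ∘ suc) (∣f∣≤c ∘ suc)))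
∣⋃[]∣≤ (outside ∷ I) f ∣f∣≤c = ∣⋃[]∣≤ I (f ∘ suc) (∣f∣≤c ∘ suc)

∈⋃[] : ∀ (I : Subset m) (f : Fin m → Subset n) {i x} → i ∈ I → x ∈ f i → x ∈ ⋃[ I ] f
∈⋃[] (inside  ∷ I) f here        x∈f = p⊆p∪q _ x∈f
∈⋃[] (inside  ∷ I) f (there i∈I) x∈f = q⊆p∪q _ _ (∈⋃[] I (f ∘ suc) i∈I x∈f)
∈⋃[] (outside ∷ I) f (there i∈I) x∈f = ∈⋃[] I (f ∘ suc) i∈I x∈f

image : (Fin a → Fin n) → Subset n
image f = ⋃[ ⊤ ] (⁅_⁆ ∘ f)

∣image∣≤ : (f : Fin a → Fin n) → ∣ image f ∣ ≤ a
∣image∣≤ {a} f = ≤-trans (∣⋃[]∣≤ ⊤ (⁅_⁆ ∘ f) (≤-reflexive ∘ ∣⁅x⁆∣≡1 ∘ f))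
                         (≤-reflexive (trans (*-identityʳ ∣ ⊤ {a} ∣) (∣⊤∣≡n a)))

∈image : (f : Fin a → Fin n) (i : Fin a) → f i ∈ image f
∈image f i = ∈⋃[] ⊤ (⁅_⁆ ∘ f) ∈⊤ (x∈⁅x⁆ (f i))

∣p∣<∣q∣⇒∃x∈q─p : {p q : Subset n} → ∣ p ∣ < ∣ q ∣ → ∃ λ x → x ∈ q × x ∉ p
∣p∣<∣q∣⇒∃x∈q─p {p = p} {q} ∣p∣<∣q∣ with any? (λ x → (x ∈? q) ×-dec ¬? (x ∈? p))
... | yes x∈q─p = x∈q─p
... | no ∄x = contradiction (p⊆q⇒∣p∣≤∣q∣ q⊆p) (<⇒≱ ∣p∣<∣q∣)
  where
  q⊆p : q ⊆ p
  q⊆p {x} x∈q with x ∈? p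
  ... | yes x∈p = x∈p
  ... | no  x∉p = contradiction (x , x∈q , x∉p) ∄x

Chosen-full : ∀ {b T S x} → Chosen {n} b T S → x ∈ T → x ∉ S → ∣ S ∣ ≡ b
Chosen-full {b = b} {T} {S} {x} (S⊆T , ∣S∣≡b⊓∣T∣) x∈T x∉S with ≤-total b ∣ T ∣
... | inj₁ b≤∣T∣ = trans ∣S∣≡b⊓∣T∣ (m≤n⇒m⊓n≡m b≤∣T∣)
... | inj₂ ∣T∣≤b = contradiction (trans ∣S∣≡b⊓∣T∣ (m≥n⇒m⊓n≡n ∣T∣≤b)) (<⇒≢ ∣S∣<∣T∣)
  where
  ∣S∣<∣T∣ : ∣ S ∣ < ∣ T ∣
  ∣S∣<∣T∣ = ≤-<-trans (p⊆q⇒∣p∣≤∣q∣ S⊆T-x) (x∈p⇒∣p-x∣<∣p∣ x∈T)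
    where
    S⊆T-x : S ⊆ T - x
    S⊆T-x y∈S = x∈p∧x≢y⇒x∈p-y (S⊆T y∈S) (λ { refl → x∉S y∈S })

∈tabulate⁺ : ∀ {f : Fin n → Bool} {x} → f x ≡ true → x ∈ tabulate f
∈tabulate⁺ {f = f} {x} fx≡true = lookup⇒[]= x (tabulate f) (trans (lookup∘tabulate f x) fx≡true)

∈tabulate⁻ : ∀ {f : Fin n → Bool} {x} → x ∈ tabulate f → f x ≡ true
∈tabulate⁻ {f = f} {x} x∈f = trans (sym (lookup∘tabulate f x)) ([]=⇒lookup x∈f)

x∉p⇒lookup≡false : ∀ {p : Subset n} {x} → x ∉ p → lookup p x ≡ false
x∉p⇒lookup≡false {p = p} {x} x∉p with lookup p x in eq
... | true  = contradiction (lookup⇒[]= x p eq) x∉p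
... | false = refl

lookup≡false⇒x∉p : ∀ {p : Subset n} {x} → lookup p x ≡ false → x ∉ p
lookup≡false⇒x∉p eq x∈p with trans (sym ([]=⇒lookup x∈p)) eq
... | ()

sameSide : ∀ {p : Subset n} {x y} → x ∈ p → y ∈ p → y ∈ p ⇔ x ∈ p
sameSide x∈p y∈p = mk⇔ (const x∈p) (const y∈p)

sameSide-∁ : ∀ {p : Subset n} {x y} → x ∉ p → y ∈ ∁ p → y ∈ p ⇔ x ∈ p
sameSide-∁ x∉p y∈∁p = mk⇔ (⊥-elim ∘ x∈∁p⇒x∉p y∈∁p) (⊥-elim ∘ x∉p)

-- Transpositions

transpose-matchˡ : ∀ (i j : Fin n) → transpose i j i ≡ j
transpose-matchˡ i j with i ≟ i
... | yes _  = refl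
... | no i≢i = contradiction refl i≢i

transpose-matchʳ : ∀ (i j : Fin n) → transpose i j j ≡ i
transpose-matchʳ i j with j ≟ i
... | yes j≡i = j≡i
... | no _ with j ≟ j
...   | yes _  = refl
...   | no j≢j = contradiction refl j≢j

transpose-other : ∀ (i j : Fin n) {k} → k ≢ i → k ≢ j → transpose i j k ≡ k
transpose-other i j {k} k≢i k≢j with k ≟ i
... | yes k≡i = contradiction k≡i k≢i
... | no _ with k ≟ j
...   | yes k≡j = contradiction k≡j k≢j
...   | no _    = refl

transpose-comm : ∀ (i j k : Fin n) → transpose i j k ≡ transpose j i k
transpose-comm i j k = by-cases (k ≟ i) (k ≟ j)
  where
  by-cases : Dec (k ≡ i) → Dec (k ≡ j) → transpose i j k ≡ transpose j i k
  by-cases (yes refl) _          = trans (transpose-matchˡ i j) (sym (transpose-matchʳ j i))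
  by-cases (no _)     (yes refl) = trans (transpose-matchʳ i j) (sym (transpose-matchˡ j i))
  by-cases (no k≢i)   (no k≢j)   = trans (transpose-other i j k≢i k≢j) (sym (transpose-other j i k≢j k≢i))

transpose-involutive : ∀ (i j k : Fin n) → transpose i j (transpose i j k) ≡ k
transpose-involutive i j k = trans (cong (transpose i j) (transpose-comm i j k)) (transpose-inverse i j)

transpose-injective : ∀ (i j : Fin n) → Injective _≡_ _≡_ (transpose i j)
transpose-injective i j {k} {k′} eq =
  trans (sym (transpose-involutive i j k)) (trans (cong (transpose i j) eq) (transpose-involutive i j k′))

transpose-resp-⇔ : ∀ (P : Fin n → Set) (i j : Fin n) → (P i ⇔ P j) → ∀ k → P (transpose i j k) ⇔ P k
transpose-resp-⇔ P i j Pi⇔Pj k = by-cases (k ≟ i) (k ≟ j)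
  where
  by-cases : Dec (k ≡ i) → Dec (k ≡ j) → P (transpose i j k) ⇔ P k
  by-cases (yes refl) _          = subst (λ l → P l ⇔ P k) (sym (transpose-matchˡ i j)) (⇔.sym Pi⇔Pj)
  by-cases (no _)     (yes refl) = subst (λ l → P l ⇔ P k) (sym (transpose-matchʳ i j)) Pi⇔Pj
  by-cases (no k≢i)   (no k≢j)   = subst (λ l → P l ⇔ P k) (sym (transpose-other i j k≢i k≢j)) ⇔.refl

-- Graphs and packings of A-paths

module _ {n : ℕ} (G : Graph n) where

  Edge-sym : ∀ {a b} → Edge G a b → Edge G b a
  Edge-sym {a} {b} e = trans (adj-sym G b a) e

  Edge-irrefl : ∀ {a b} → Edge G a b → a ≢ b
  Edge-irrefl {a} e refl with trans (sym e) (adj-irr G a)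
  ... | ()

  ∈Nbh⁺ : ∀ {u y} → Edge G u y → y ∈ Nbh G u
  ∈Nbh⁺ = ∈tabulate⁺

  ∈Nbh⁻ : ∀ {u y} → y ∈ Nbh G u → Edge G u y
  ∈Nbh⁻ = ∈tabulate⁻

module _ {n : ℕ} (G : Graph n) (M : Subset n) where

  x∈cliqueOf : ∀ {x} → x ∉ M → x ∈ cliqueOf G M x
  x∈cliqueOf {x} x∉M = ∈tabulate⁺ (Equivalence.to T-≡ (Equivalence.from T-∧
    ( Equivalence.from T-not-≡ (x∉p⇒lookup≡false x∉M)
    , Equivalence.from (T-∨ {⌊ x ≟ x ⌋}) (inj₁ (fromWitness refl)))))

  ∈cliqueOf⁻ : ∀ {x y} → y ∈ cliqueOf G M x → y ∉ M × (y ≡ x ⊎ Edge G y x)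
  ∈cliqueOf⁻ y∈Q with Equivalence.to T-∧ (Equivalence.from T-≡ (∈tabulate⁻ y∈Q))
  ... | y∉M , y≡x∨y~x =
    lookup≡false⇒x∉p (Equivalence.to T-not-≡ y∉M) ,
    Sum.map toWitness (Equivalence.to T-≡) (Equivalence.to T-∨ y≡x∨y~x)

module _ {n : ℕ} {G : Graph n} {A : Subset n} {k ℓ : ℕ} where

  vertex : Packing G A k ℓ → Fin k → Fin (suc ℓ) → Fin n
  vertex 𝒫 j = vtx (path 𝒫 j)

  vertex-injective : ∀ (𝒫 : Packing G A k ℓ) {j j′ p p′} → vertex 𝒫 j p ≡ vertex 𝒫 j′ p′ → j ≡ j′ × p ≡ p′
  vertex-injective 𝒫 {j} {j′} {p} {p′} eq with j ≟ j′
  ... | yes refl = refl , distinct (path 𝒫 j) p p′ eq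
  ... | no j≢j′  = contradiction eq (disjoint 𝒫 j j′ j≢j′ p p′)

  Next : Packing G A k ℓ → Fin n → Fin n → Set
  Next 𝒫 a b = ∃₂ λ j t → vertex 𝒫 j (inject₁ t) ≡ a × vertex 𝒫 j (suc t) ≡ b

  Adjacent : Packing G A k ℓ → Fin n → Fin n → Set
  Adjacent 𝒫 a b = Next 𝒫 a b ⊎ Next 𝒫 b a

  module _ (𝒫 : Packing G A k ℓ) where

    Next⇒Edge : ∀ {a b} → Next 𝒫 a b → Edge G a b
    Next⇒Edge (j , t , refl , refl) = edges (path 𝒫 j) t

    Adjacent⇒Edge : ∀ {a b} → Adjacent 𝒫 a b → Edge G a b
    Adjacent⇒Edge (inj₁ a→b) = Next⇒Edge a→b
    Adjacent⇒Edge (inj₂ b→a) = Edge-sym G (Next⇒Edge b→a)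

    Adjacent⇒∈Nbh : ∀ {a b} → Adjacent 𝒫 a b → a ∈ Nbh G b
    Adjacent⇒∈Nbh = ∈Nbh⁺ G ∘ Edge-sym G ∘ Adjacent⇒Edge

    Adjacent-sym : ∀ {a b} → Adjacent 𝒫 a b → Adjacent 𝒫 b a
    Adjacent-sym (inj₁ a→b) = inj₂ a→b
    Adjacent-sym (inj₂ b→a) = inj₁ b→a

    Next-functional : ∀ {a b c} → Next 𝒫 a b → Next 𝒫 a c → b ≡ c
    Next-functional (j , t , refl , refl) (j′ , t′ , eq , refl) with vertex-injective 𝒫 eq
    ... | refl , t′≡t rewrite inject₁-injective t′≡t = refl

    Next-injective : ∀ {a b c} → Next 𝒫 a c → Next 𝒫 b c → a ≡ b
    Next-injective (j , t , refl , refl) (j′ , t′ , refl , eq) with vertex-injective 𝒫 eq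
    ... | refl , 1+t′≡1+t rewrite suc-injective 1+t′≡1+t = refl

    Next-asym : ∀ {a b} → Next 𝒫 a b → ¬ Next 𝒫 b a
    Next-asym (j , t , refl , refl) (j′ , t′ , eq₁ , eq₂) with vertex-injective 𝒫 eq₁ | vertex-injective 𝒫 eq₂
    ... | _ , t′≡1+t | _ , 1+t′≡t = m≢1+n+m (toℕ t) {1} (begin
      toℕ t                  ≡⟨ toℕ-inject₁ t ⟨
      toℕ (inject₁ t)        ≡⟨ cong toℕ 1+t′≡t ⟨
      suc (toℕ t′)           ≡⟨ cong suc (toℕ-inject₁ t′) ⟨
      suc (toℕ (inject₁ t′)) ≡⟨ cong (suc ∘ toℕ) t′≡1+t ⟩
      suc (suc (toℕ t))      ∎)
      where open ≡-Reasoning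

    Next-Next⇒∉A : ∀ {a b c} → Next 𝒫 a b → Next 𝒫 b c → b ∉ A
    Next-Next⇒∉A (j , t , _ , refl) (j′ , t′ , eq , _) with vertex-injective 𝒫 eq | isAPath 𝒫 j
    ... | refl , t′≡1+t | _ , _ , _ , interior∉A =
      interior∉A (suc t) (λ ()) (λ 1+t≡ℓ → fromℕ≢inject₁ (trans (sym 1+t≡ℓ) (sym t′≡1+t)))

  ReplaceableBy : Packing G A k ℓ → Fin n → Fin n → Set
  ReplaceableBy 𝒫 x y = ∀ {c} → Adjacent 𝒫 x c → c ≢ y → Edge G y c

  relabel : (𝒫 : Packing G A k ℓ) (π : Fin n → Fin n) → Injective _≡_ _≡_ π → (∀ a → π a ∈ A ⇔ a ∈ A) →
            (∀ {a c} → Next 𝒫 a c → Edge G (π a) (π c)) → Packing G A k ℓ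
  relabel 𝒫 π π-injective π-resp-A π-edge = record
    { path     = path′
    ; isAPath  = isAPath′
    ; disjoint = λ j j′ j≢j′ p p′ → disjoint 𝒫 j j′ j≢j′ p p′ ∘ π-injective }
    where
    path′ : Fin k → Path G ℓ
    path′ j = record
      { vtx      = π ∘ vertex 𝒫 j
      ; distinct = λ p p′ → distinct (path 𝒫 j) p p′ ∘ π-injective
      ; edges    = λ t → π-edge (j , t , refl , refl) }

    isAPath′ : ∀ j → IsAPath G A (path′ j)
    isAPath′ j with isAPath 𝒫 j
    ... | start∈A , end∈A , start≢end , interior∉A =
      Equivalence.from (π-resp-A _) start∈A , Equivalence.from (π-resp-A _) end∈A , start≢end ∘ π-injective ,
      λ p p≢start p≢end → interior∉A p p≢start p≢end ∘ Equivalence.to (π-resp-A _)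

  module Swap (𝒫 : Packing G A k ℓ) {x y : Fin n}
              (x⇔y : x ∈ A ⇔ y ∈ A) (x↝y : ReplaceableBy 𝒫 x y) (y↝x : ReplaceableBy 𝒫 y x) where

    private
      τ : Fin n → Fin n
      τ = transpose x y

      edge-at : ∀ x′ y′ {c} → ReplaceableBy 𝒫 x′ y′ → Adjacent 𝒫 x′ c →
                Edge G (transpose x′ y′ x′) (transpose x′ y′ c)
      edge-at x′ y′ {c} x′↝y′ x′~c rewrite transpose-matchˡ x′ y′ with c ≟ y′
      ... | yes refl rewrite transpose-matchʳ x′ y′ = Edge-sym G (Adjacent⇒Edge 𝒫 x′~c)
      ... | no c≢y′ rewrite transpose-other x′ y′ (Edge-irrefl G (Adjacent⇒Edge 𝒫 x′~c) ∘ sym) c≢y′ = x′↝y′ x′~c c≢y′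

      edge-at-swapped : ∀ {a c} → a ≡ x ⊎ a ≡ y → Adjacent 𝒫 a c → Edge G (τ a) (τ c)
      edge-at-swapped (inj₁ refl) = edge-at x y x↝y
      edge-at-swapped {a} {c} (inj₂ refl) a~c =
        subst₂ (Edge G) (transpose-comm y x a) (transpose-comm y x c) (edge-at y x y↝x a~c)

      τ-fixes : ∀ {a} → ¬ (a ≡ x ⊎ a ≡ y) → τ a ≡ a
      τ-fixes a∉xy = transpose-other x y (a∉xy ∘ inj₁) (a∉xy ∘ inj₂)

      τ-edge : ∀ {a c} → Adjacent 𝒫 a c → Edge G (τ a) (τ c)
      τ-edge {a} {c} a~c with (a ≟ x) ⊎-dec (a ≟ y) | (c ≟ x) ⊎-dec (c ≟ y)
      ... | yes a∈xy | _        = edge-at-swapped a∈xy a~c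
      ... | no _     | yes c∈xy = Edge-sym G (edge-at-swapped c∈xy (Adjacent-sym 𝒫 a~c))
      ... | no a∉xy  | no c∉xy  = subst₂ (Edge G) (sym (τ-fixes a∉xy)) (sym (τ-fixes c∉xy)) (Adjacent⇒Edge 𝒫 a~c)

    swapped : Packing G A k ℓ
    swapped = relabel 𝒫 τ (transpose-injective x y) (transpose-resp-⇔ (_∈ A) x y x⇔y) (τ-edge ∘ inj₁)

  locate : ∀ 𝒫 u → Dec (∃₂ λ j p → vertex 𝒫 j p ≡ u)
  locate 𝒫 u = any? (λ j → any? (λ p → vertex 𝒫 j p ≟ u))

  pathmates : Packing G A k ℓ → Fin n → Subset n
  pathmates 𝒫 u with locate 𝒫 u
  ... | yes (j , p , _) = image (vertex 𝒫 j ∘ punchIn p)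
  ... | no _            = ⊥

  ∣pathmates∣≤ℓ : ∀ 𝒫 u → ∣ pathmates 𝒫 u ∣ ≤ ℓ
  ∣pathmates∣≤ℓ 𝒫 u with locate 𝒫 u
  ... | yes (j , p , _) = ∣image∣≤ (vertex 𝒫 j ∘ punchIn p)
  ... | no _            = ≤-trans (≤-reflexive (∣⊥∣≡0 n)) z≤n

  ∈pathmates : ∀ 𝒫 {j p r} → p ≢ r → vertex 𝒫 j r ∈ pathmates 𝒫 (vertex 𝒫 j p)
  ∈pathmates 𝒫 {j} {p} {r} p≢r with locate 𝒫 (vertex 𝒫 j p)
  ... | no ∄jp = contradiction (j , p , refl) ∄jp
  ... | yes (j′ , p′ , eq) with vertex-injective 𝒫 eq
  ...   | refl , refl = subst (_∈ image (vertex 𝒫 j ∘ punchIn p)) (cong (vertex 𝒫 j) (punchIn-punchOut p≢r))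
                              (∈image (vertex 𝒫 j ∘ punchIn p) (punchOut p≢r))

-- Paths meeting M

module _ {n : ℕ} {G : Graph n} {A : Subset n} {k ℓ : ℕ} (M : Subset n) where

  Touches : Packing G A k ℓ → Fin k → Set
  Touches 𝒫 j = ∃ λ p → vertex 𝒫 j p ∈ M

  Untouched : Packing G A k ℓ → Fin n → Set
  Untouched 𝒫 v = ∀ j p → vertex 𝒫 j p ≡ v → ¬ Touches 𝒫 j

  Untouched-image : ∀ (𝒫 𝒫′ : Packing G A k ℓ) (π : Fin n → Fin n) → (∀ j p → vertex 𝒫′ j p ≡ π (vertex 𝒫 j p)) →
                    (∀ {a} → π a ∈ M → a ∈ M) → ∀ {v w} → (∀ {a} → π a ≡ v → a ≡ w) →
                    Untouched 𝒫 w → Untouched 𝒫′ v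
  Untouched-image 𝒫 𝒫′ π 𝒫′≡π𝒫 π-reflects-M π⁻¹v≡w w-untouched j p 𝒫′jp≡v (p′ , 𝒫′jp′∈M) =
    w-untouched j p (π⁻¹v≡w (trans (sym (𝒫′≡π𝒫 j p)) 𝒫′jp≡v))
                    (p′ , π-reflects-M (subst (_∈ M) (𝒫′≡π𝒫 j p′) 𝒫′jp′∈M))

  Untouched-Adjacent⇒∉ : ∀ 𝒫 {v c} → Untouched 𝒫 v → Adjacent 𝒫 v c → c ∉ M
  Untouched-Adjacent⇒∉ 𝒫 v-untouched (inj₁ (j , t , v≡ , refl)) c∈M = v-untouched j (inject₁ t) v≡ (suc t , c∈M)
  Untouched-Adjacent⇒∉ 𝒫 v-untouched (inj₂ (j , t , refl , v≡)) c∈M = v-untouched j (suc t) v≡ (inject₁ t , c∈M)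

  touchedZone : Packing G A k ℓ → Subset n
  touchedZone 𝒫 = ⋃[ M ] pathmates 𝒫

  ∣touchedZone∣≤ : ∀ 𝒫 → ∣ touchedZone 𝒫 ∣ ≤ ∣ M ∣ * ℓ
  ∣touchedZone∣≤ 𝒫 = ∣⋃[]∣≤ M (pathmates 𝒫) (∣pathmates∣≤ℓ 𝒫)

  ∉touchedZone⇒Untouched : ∀ {𝒫 v} → v ∉ M → v ∉ touchedZone 𝒫 → Untouched 𝒫 v
  ∉touchedZone⇒Untouched {𝒫} v∉M v∉zone j r refl (p , p∈M) =
    v∉zone (∈⋃[] M (pathmates 𝒫) p∈M (∈pathmates 𝒫 λ { refl → v∉M p∈M }))

  SeesMNeighbours : Packing G A k ℓ → Fin n → Fin n → Set
  SeesMNeighbours 𝒫 x y = ∀ {u} → Adjacent 𝒫 x u → u ∈ M → Edge G y u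

  module _ (𝒫 : Packing G A k ℓ) {x y : Fin n} where

    sees-none : (∀ {u} → Adjacent 𝒫 x u → u ∉ M) → SeesMNeighbours 𝒫 x y
    sees-none no-M x~u u∈M = contradiction u∈M (no-M x~u)

    sees-one : ∀ {u} → (∀ {u′} → Adjacent 𝒫 x u′ → u′ ∈ M → u′ ≡ u) → y ∈ Nbh G u → SeesMNeighbours 𝒫 x y
    sees-one only-u y∈N x~u′ u′∈M rewrite only-u x~u′ u′∈M = Edge-sym G (∈Nbh⁻ G y∈N)

    sees-two : ∀ {u w} → (∀ {u′} → Adjacent 𝒫 x u′ → u′ ∈ M → u′ ≡ u ⊎ u′ ≡ w) → y ∈ Nbh G u × y ∈ Nbh G w →
               SeesMNeighbours 𝒫 x y
    sees-two only-uw (y∈Nu , y∈Nw) x~u′ u′∈M with only-uw x~u′ u′∈M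
    ... | inj₁ refl = Edge-sym G (∈Nbh⁻ G y∈Nu)
    ... | inj₂ refl = Edge-sym G (∈Nbh⁻ G y∈Nw)

  data MNeighbours (𝒫 : Packing G A k ℓ) (x : Fin n) : Set where
    none : (∀ {u} → Adjacent 𝒫 x u → u ∉ M) → MNeighbours 𝒫 x
    one  : ∀ {u} → u ∈ M → Adjacent 𝒫 x u → (∀ {u′} → Adjacent 𝒫 x u′ → u′ ∈ M → u′ ≡ u) → MNeighbours 𝒫 x
    two  : ∀ {u w} → u ∈ M → w ∈ M → u ≢ w → Adjacent 𝒫 x u → Adjacent 𝒫 x w → x ∉ A →
           (∀ {u′} → Adjacent 𝒫 x u′ → u′ ∈ M → u′ ≡ u ⊎ u′ ≡ w) → MNeighbours 𝒫 x

  module _ (𝒫 : Packing G A k ℓ) where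

    successor∈M? : ∀ x → Dec (∃ λ u → Next 𝒫 x u × u ∈ M)
    successor∈M? x = map′ (λ { (j , t , eq , u∈M) → _ , (j , t , eq , refl) , u∈M })
                          (λ { (_ , (j , t , eq , refl) , u∈M) → j , t , eq , u∈M })
                          (any? λ j → any? λ t → (vertex 𝒫 j (inject₁ t) ≟ x) ×-dec (vertex 𝒫 j (suc t) ∈? M))

    predecessor∈M? : ∀ x → Dec (∃ λ w → Next 𝒫 w x × w ∈ M)
    predecessor∈M? x = map′ (λ { (j , t , eq , w∈M) → _ , (j , t , refl , eq) , w∈M })
                            (λ { (_ , (j , t , refl , eq) , w∈M) → j , t , eq , w∈M })
                            (any? λ j → any? λ t → (vertex 𝒫 j (suc t) ≟ x) ×-dec (vertex 𝒫 j (inject₁ t) ∈? M))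

    classify : ∀ x → MNeighbours 𝒫 x
    classify x with successor∈M? x | predecessor∈M? x
    ... | yes (u , x→u , u∈M) | yes (w , w→x , w∈M) =
      two u∈M w∈M (λ { refl → Next-asym 𝒫 x→u w→x }) (inj₁ x→u) (inj₂ w→x) (Next-Next⇒∉A 𝒫 w→x x→u)
        λ { (inj₁ x→u′) _ → inj₁ (Next-functional 𝒫 x→u′ x→u) ; (inj₂ u′→x) _ → inj₂ (Next-injective 𝒫 u′→x w→x) }
    ... | yes (u , x→u , u∈M) | no ∄w =
      one u∈M (inj₁ x→u)
        λ { (inj₁ x→u′) _ → Next-functional 𝒫 x→u′ x→u ; (inj₂ u′→x) u′∈M → contradiction (_ , u′→x , u′∈M) ∄w }
    ... | no ∄u | yes (w , w→x , w∈M) =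
      one w∈M (inj₂ w→x)
        λ { (inj₁ x→u′) u′∈M → contradiction (_ , x→u′ , u′∈M) ∄u ; (inj₂ u′→x) _ → Next-injective 𝒫 u′→x w→x }
    ... | no ∄u | no ∄w =
      none λ { (inj₁ x→u) u∈M → ∄u (_ , x→u , u∈M) ; (inj₂ u→x) u∈M → ∄w (_ , u→x , u∈M) }

-- Exchanging unmarked vertices

module _ {n : ℕ} {G : Graph n} {A M : Subset n} {k ℓ : ℕ} (mc : MarkingChoice G A M ℓ) where

  Good : Packing G A k ℓ → Fin n → Set
  Good 𝒫 v = v ∈ M ⊎ Marked mc v ⊎ Untouched M 𝒫 v

  Good-touched : ∀ 𝒫 {i q} → Good 𝒫 (vertex 𝒫 i q) → Touches M 𝒫 i → vertex 𝒫 i q ∈ M ⊎ Marked mc (vertex 𝒫 i q)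
  Good-touched _ (inj₁ v∈M)              _       = inj₁ v∈M
  Good-touched _ (inj₂ (inj₁ marked))    _       = inj₂ marked
  Good-touched _ (inj₂ (inj₂ untouched)) touches = ⊥-elim (untouched _ _ refl touches)

  record Candidates (𝒫 : Packing G A k ℓ) (x : Fin n) : Set where
    field
      T S         : Subset n
      chosen      : Chosen (b mc) T S
      x∈T         : x ∈ T
      ∈T⇒∈clique  : ∀ {y} → y ∈ T → y ∈ cliqueOf G M x
      ∈T⇒sameSide : ∀ {y} → y ∈ T → y ∈ A ⇔ x ∈ A
      ∈T⇒sees     : ∀ {y} → y ∈ T → SeesMNeighbours M 𝒫 x y
      ∈S⇒marked   : ∀ {y} → y ∈ S → Marked mc y

  candidatesWithin : ∀ {𝒫 x} → x ∉ M → (R S : Subset n) → Chosen (b mc) (cliqueOf G M x ∩ R) S → x ∈ R →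
                     (∀ {y} → y ∈ R → (y ∈ A ⇔ x ∈ A) × SeesMNeighbours M 𝒫 x y) →
                     (∀ {y} → y ∈ S → Marked mc y) → Candidates 𝒫 x
  candidatesWithin {x = x} x∉M R S chosen x∈R R-ok S-marked = record
    { T           = cliqueOf G M x ∩ R
    ; S           = S
    ; chosen      = chosen
    ; x∈T         = x∈p∩q⁺ (x∈cliqueOf G M x∉M , x∈R)
    ; ∈T⇒∈clique  = proj₁ ∘ x∈p∩q⁻ _ _
    ; ∈T⇒sameSide = proj₁ ∘ R-ok ∘ proj₂ ∘ x∈p∩q⁻ _ _
    ; ∈T⇒sees     = proj₂ ∘ R-ok ∘ proj₂ ∘ x∈p∩q⁻ _ _
    ; ∈S⇒marked   = S-marked
    }

  candidates : ∀ {𝒫 x} → x ∉ M → Candidates 𝒫 x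
  candidates {𝒫} {x} x∉M with classify M 𝒫 x | x ∈? A
  ... | none no-M | yes x∈A =
    candidatesWithin x∉M A _ (ok3A mc x x∉M) x∈A
      (λ y∈A → sameSide x∈A y∈A , sees-none M 𝒫 no-M)
      (λ y∈S → x , x∉M , inj₂ (inj₂ (inj₁ y∈S)))
  ... | none no-M | no x∉A =
    candidatesWithin x∉M (∁ A) _ (ok3N mc x x∉M) (x∉p⇒x∈∁p x∉A)
      (λ y∈∁A → sameSide-∁ x∉A y∈∁A , sees-none M 𝒫 no-M)
      (λ y∈S → x , x∉M , inj₂ (inj₂ (inj₂ y∈S)))
  ... | one {u} u∈M x~u only-u | yes x∈A =
    candidatesWithin x∉M (A ∩ Nbh G u) _ (ok1A mc x x∉M u u∈M) (x∈p∩q⁺ (x∈A , Adjacent⇒∈Nbh 𝒫 x~u))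
      (λ y∈R → let y∈A , y∈N = x∈p∩q⁻ _ _ y∈R in sameSide x∈A y∈A , sees-one M 𝒫 only-u y∈N)
      (λ y∈S → x , x∉M , inj₁ (u , u∈M , inj₁ y∈S))
  ... | one {u} u∈M x~u only-u | no x∉A =
    candidatesWithin x∉M (∁ A ∩ Nbh G u) _ (ok1N mc x x∉M u u∈M)
      (x∈p∩q⁺ (x∉p⇒x∈∁p x∉A , Adjacent⇒∈Nbh 𝒫 x~u))
      (λ y∈R → let y∈∁A , y∈N = x∈p∩q⁻ _ _ y∈R in sameSide-∁ x∉A y∈∁A , sees-one M 𝒫 only-u y∈N)
      (λ y∈S → x , x∉M , inj₁ (u , u∈M , inj₂ y∈S))
  ... | two {u} {w} u∈M w∈M u≢w x~u x~w x∉A only-uw | _ =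
    candidatesWithin x∉M (∁ A ∩ (Nbh G u ∩ Nbh G w)) _ (ok2 mc x x∉M u w u∈M w∈M u≢w)
      (x∈p∩q⁺ (x∉p⇒x∈∁p x∉A , x∈p∩q⁺ (Adjacent⇒∈Nbh 𝒫 x~u , Adjacent⇒∈Nbh 𝒫 x~w)))
      (λ y∈R → let y∈∁A , y∈N = x∈p∩q⁻ _ _ y∈R in
               sameSide-∁ x∉A y∈∁A , sees-two M 𝒫 only-uw (x∈p∩q⁻ _ _ y∈N))
      (λ y∈S → x , x∉M , inj₂ (inj₁ (u , w , u∈M , w∈M , u≢w , y∈S)))

  Improvement : Packing G A k ℓ → Fin n → Set
  Improvement 𝒫 x = Σ (Packing G A k ℓ) λ 𝒫′ → Good 𝒫′ x × (∀ {v} → Good 𝒫 v → Good 𝒫′ v)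

  unusedCandidate : ∀ {𝒫 x} (C : Candidates 𝒫 x) → x ∉ Candidates.S C →
                    ∃ λ y → y ∈ Candidates.S C × y ∉ touchedZone M 𝒫
  unusedCandidate {𝒫} {x} C x∉S = ∣p∣<∣q∣⇒∃x∈q─p (begin-strict
    ∣ touchedZone M 𝒫 ∣ ≤⟨ ∣touchedZone∣≤ M 𝒫 ⟩
    ∣ M ∣ * ℓ           ≡⟨ *-comm ∣ M ∣ ℓ ⟩
    ℓ * ∣ M ∣           <⟨ m<m+n (ℓ * ∣ M ∣) (s≤s z≤n) ⟩
    ℓ * ∣ M ∣ + 1       ≡⟨ Chosen-full chosen x∈T x∉S ⟨
    ∣ S ∣               ∎)
    where
    open Candidates C
    open ≤-Reasoning

  module _ (cluster : IsClusterDeletion G M) where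

    exchange : ∀ {𝒫 x y} → x ∉ M → (C : Candidates 𝒫 x) → x ∉ Candidates.S C →
               y ∈ Candidates.S C → y ∉ touchedZone M 𝒫 → Improvement 𝒫 x
    exchange {𝒫} {x} {y} x∉M C x∉S y∈S y∉zone = 𝒫′ , good-x , preserve
      where
      open Candidates C

      y∈T : y ∈ T
      y∈T = proj₁ chosen y∈S

      y∉M : y ∉ M
      y∉M = proj₁ (∈cliqueOf⁻ G M (∈T⇒∈clique y∈T))

      y~x : Edge G y x
      y~x with proj₂ (∈cliqueOf⁻ G M (∈T⇒∈clique y∈T))
      ... | inj₁ refl = contradiction y∈S x∉S
      ... | inj₂ y~x  = y~x

      y-untouched : Untouched M 𝒫 y
      y-untouched = ∉touchedZone⇒Untouched M y∉M y∉zone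

      x↝y : ReplaceableBy 𝒫 x y
      x↝y {c} x~c c≢y with c ∈? M
      ... | yes c∈M = ∈T⇒sees y∈T x~c c∈M
      ... | no  c∉M = cluster y x c y∉M x∉M c∉M y~x (Adjacent⇒Edge 𝒫 x~c) (c≢y ∘ sym)

      y↝x : ReplaceableBy 𝒫 y x
      y↝x {c} y~c c≢x = cluster x y c x∉M y∉M (Untouched-Adjacent⇒∉ M 𝒫 y-untouched y~c)
                                (Edge-sym G y~x) (Adjacent⇒Edge 𝒫 y~c) (c≢x ∘ sym)

      𝒫′ : Packing G A k ℓ
      𝒫′ = Swap.swapped 𝒫 (⇔.sym (∈T⇒sameSide y∈T)) x↝y y↝x

      moved : ∀ {v} → Untouched M 𝒫 (transpose x y v) → Untouched M 𝒫′ v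
      moved = Untouched-image M 𝒫 𝒫′ (transpose x y) (λ _ _ → refl)
        (Equivalence.to (transpose-resp-⇔ (_∈ M) x y (mk⇔ (⊥-elim ∘ x∉M) (⊥-elim ∘ y∉M)) _))
        (λ { refl → sym (transpose-involutive x y _) })

      good-x : Good 𝒫′ x
      good-x = inj₂ (inj₂ (moved (subst (Untouched M 𝒫) (sym (transpose-matchˡ x y)) y-untouched)))

      preserve : ∀ {v} → Good 𝒫 v → Good 𝒫′ v
      preserve {v} good with v ≟ x | v ≟ y
      ... | yes refl | _        = good-x
      ... | no _     | yes refl = inj₂ (inj₁ (∈S⇒marked y∈S))
      ... | no v≢x   | no v≢y   =
        Sum.map₂ (Sum.map₂ (moved ∘ subst (Untouched M 𝒫) (sym (transpose-other x y v≢x v≢y)))) good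

    improveOutsideM : ∀ {𝒫 x} → x ∉ M → Candidates 𝒫 x → Improvement 𝒫 x
    improveOutsideM {𝒫} {x} x∉M C with x ∈? Candidates.S C
    ... | yes x∈S = 𝒫 , inj₂ (inj₁ (Candidates.∈S⇒marked C x∈S)) , λ good → good
    ... | no  x∉S with unusedCandidate C x∉S
    ...   | y , y∈S , y∉zone = exchange x∉M C x∉S y∈S y∉zone

    improve : ∀ 𝒫 x → Improvement 𝒫 x
    improve 𝒫 x with x ∈? M
    ... | yes x∈M = 𝒫 , inj₁ x∈M , λ good → good
    ... | no  x∉M = improveOutsideM x∉M (candidates {𝒫} x∉M)

    improveAll : Packing G A k ℓ → (vs : List (Fin n)) → Σ (Packing G A k ℓ) λ 𝒫′ → All (Good 𝒫′) vs
    improveAll 𝒫 []       = 𝒫 , []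
    improveAll 𝒫 (v ∷ vs) with improveAll 𝒫 vs
    ... | 𝒫₁ , all-good with improve 𝒫₁ v
    ...   | 𝒫₂ , v-good , preserve = 𝒫₂ , v-good ∷ All.map preserve all-good

mainTheorem8 : ∀ {n : ℕ} (G : Graph n) (A M : Subset n) (k ℓ : ℕ) →
  Packing G A k ℓ →
  IsClusterDeletion G M →
  (mc : MarkingChoice G A M ℓ) →
  Σ (Packing G A k ℓ) λ 𝒫 →
    ∀ (i : Fin k) →
      (Σ (Fin _) λ p → vtx (path 𝒫 i) p ∈ M) →
      ∀ q → (vtx (path 𝒫 i) q ∈ M) ⊎ Marked mc (vtx (path 𝒫 i) q)
mainTheorem8 G A M k ℓ 𝒫 cluster mc with improveAll mc cluster 𝒫 (allFin _)
... | 𝒫′ , all-good = 𝒫′ , λ i touches q → Good-touched mc 𝒫′ (All.lookup all-good (∈-allFin (vertex 𝒫′ i q))) touches
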